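{- Let $n\geq 1$, $a=[n,n+1,n+2,n+3,n+4]$, and $b=F_nF_{n+1}F_{n+2}F_{n+3}F_{n+4}$. Then \[ z(b)=\begin{cases} a, & \text{if } n\equiv 1,2,3,4,5,6,7,10 \pmod{12}, \text{ or } n\equiv 8,60\pmod{72};\\ 2a, & \text{if } n\equiv 9,11\pmod{12}, \text{ or } n\equiv 24,44\pmod{72};\\ 3a, & \text{if } n\equiv 12,32,36,56\pmod{72};\\ 6a, & \text{if } n\equiv 0,20,48,68\pmod{72}. \end{cases} \]
   Context: $F_n$ is the $n$th Fibonacci number ($F_1=F_2=1$, $F_n=F_{n-1}+F_{n-2}$). For a positive integer $m$, $z(m)$ is the smallest positive integer $k$ with $m\mid F_k$. $[\cdots]$ denotes lcm. -}

module Defs where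

open import Data.Nat using (ℕ; zero; suc; _+_; _*_; _<_; _≤_)
open import Data.Nat.Divisibility using (_∣_)
open import Data.Nat.LCM using (lcm)
open import Data.Product using (_×_)
open import Relation.Nullary using (¬_)

F : ℕ → ℕ
F zero = zero
F (suc zero) = suc zero
F (suc (suc n)) = F (suc n) + F n

IsZ : ℕ → ℕ → Set
IsZ m k = (1 ≤ k) × (m ∣ F k) × (∀ j → 1 ≤ j → j < k → ¬ (m ∣ F j))

lcm5 : ℕ → ℕ
lcm5 n = lcm n (lcm (n + 1) (lcm (n + 2) (lcm (n + 3) (n + 4))))

prod5 : ℕ → ℕ
prod5 n = F n * F (n + 1) * F (n + 2) * F (n + 3) * F (n + 4)

{-# OPTIONS --safe #-}
-- Since F_m ∣ F_K ⇔ m ∣ K for m ≥ 3, every K with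
-- b ∣ F_K is a multiple of a. Two factors F_{n+i}, F_{n+j} have a gcd dividing F_{j-i}, a divisor
-- of 6, so their parts prime to 6 are pairwise coprime: for a ∣ K, b ∣ F_K as soon as the 2- and
-- 3-parts of b divide F_K. Now ν₂(F_m) is 0, 1 or ν₂(m) + 2 according as 3 ∤ m, m is an odd
-- multiple of 3, or 6 ∣ m, and ν₃(F_m) is ν₃(m) + 1 if 4 ∣ m and 0 otherwise. As 12 ∣ a, this
-- gives z(b) = 2^e₂ 3^e₃ a with e₂ = ν₂(b) ∸ (ν₂(a) + 2) and e₃ = ν₃(b) ∸ (ν₃(a) + 1).
-- Since ν_p(a) is the largest ν_p(n + i), comparing valuations inside the window shows
-- e₂, e₃ ∈ {0, 1}: e₂ = 1 exactly when the window holds two multiples of 3 and the even one is a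
-- multiple of 12 and the window's only multiple of 8, and e₃ = 1 exactly when 4 ∣ n and the
-- window's multiple of 12 is its only multiple of 9. These conditions depend only on n mod 72,
-- so the table of the theorem is checked residue by residue.
module Submission where

open import Defs
open import Data.Nat
open import Data.Nat.Properties
open import Data.Nat.Divisibility
open import Data.Nat.DivMod
open import Data.Nat.Primality
open import Data.Nat.LCM
open import Data.Nat.GCD using (gcd)
open import Data.Nat.Coprimality using (Coprime; coprime?; coprime-divisor)
open import Data.Nat.Tactic.RingSolver
open import Data.Fin using (Fin; toℕ; fromℕ<) renaming (suc to fsuc)
open import Data.Fin.Patterns
open import Data.Fin.Properties using (all?; any?; ¬∀⟶∃¬; toℕ-fromℕ<; toℕ-injective; toℕ<n)
  renaming (_≟_ to _≟ᶠ_)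
open import Data.Product using (∃; _×_; _,_; proj₁; proj₂; map)
open import Data.Sum using (_⊎_; inj₁; inj₂; [_,_]′)
open import Data.Empty
open import Relation.Nullary
open import Relation.Nullary.Decidable
  using (True; toWitness; decidable-stable; from-yes; from-no; _⊎-dec_; _×-dec_; _→-dec_; ¬?)
open import Relation.Binary.PropositionalEquality
open import Function using (_∘_)
open import Data.List using (_∷_; [])
open import Data.List.Membership.Propositional using (_∈_)
open import Data.List.Membership.DecPropositional _≟_ using (_∈?_)

F-+ : ∀ m n → F (m + suc n) ≡ F (suc m) * F (suc n) + F m * F n
F-+ zero n = sym (trans (+-identityʳ _) (+-identityʳ _))
F-+ (suc m) n = begin
    F (suc m + suc n)                                ≡⟨ cong F (sym (+-suc m (suc n))) ⟩
    F (m + suc (suc n))                              ≡⟨ F-+ m (suc n) ⟩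
    F (suc m) * (F (suc n) + F n) + F m * F (suc n)  ≡⟨ regroup (F (suc m)) (F m) (F (suc n)) (F n) ⟩
    (F (suc m) + F m) * F (suc n) + F (suc m) * F n  ∎
  where
  open ≡-Reasoning
  regroup : ∀ a b c d → a * (c + d) + b * c ≡ (a + b) * c + a * d
  regroup = solve-∀

F-coprime-suc : ∀ n → Coprime (F n) (F (suc n))
F-coprime-suc zero          (_ , i∣1)     = ∣1⇒≡1 i∣1
F-coprime-suc (suc n) {i} (i∣a , i∣b) = F-coprime-suc n (∣m+n∣m⇒∣n i∣b i∣a , i∣a)

F-∣-+ : ∀ {d} m k → d ∣ F m → d ∣ F k → d ∣ F (k + m)
F-∣-+ {d} zero    k _  dk = subst (d ∣_) (cong F (sym (+-identityʳ k))) dk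
F-∣-+ {d} (suc m) k dm dk = subst (d ∣_) (sym (F-+ k m))
  (∣m∣n⇒∣m+n (∣n⇒∣m*n (F (suc k)) dm) (∣m⇒∣m*n (F m) dk))

F-∣-* : ∀ m k → F m ∣ F (k * m)
F-∣-* m zero    = F m ∣0
F-∣-* m (suc k) = subst (F m ∣_) (cong F (+-comm (k * m) m)) (F-∣-+ m (k * m) ∣-refl (F-∣-* m k))

F-∣-F : ∀ {m n} → m ∣ n → F m ∣ F n
F-∣-F {m} (divides k refl) = F-∣-* m k

F-∣-cancel : ∀ {d} m r → d ∣ F m → d ∣ F (m + r) → d ∣ F r
F-∣-cancel {d} m zero    _  _   = d ∣0
F-∣-cancel {d} m (suc r) dm dmr = coprime-divisor d⊥F[1+m] (∣m+n∣m⇒∣n sum (∣m⇒∣m*n (F r) dm))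
  where
  sum : d ∣ F m * F r + F (suc m) * F (suc r)
  sum = subst (d ∣_) (trans (F-+ m r) (+-comm (F (suc m) * F (suc r)) (F m * F r))) dmr
  d⊥F[1+m] : Coprime d (F (suc m))
  d⊥F[1+m] (i∣d , i∣F) = F-coprime-suc m (∣-trans i∣d dm , i∣F)

F-∣-% : ∀ {d} m n .{{_ : NonZero m}} → d ∣ F m → d ∣ F n → d ∣ F (n % m)
F-∣-% {d} m n dm dn = F-∣-cancel (n / m * m) (n % m) (∣-trans dm (F-∣-* m (n / m)))
  (subst (λ x → d ∣ F x) (trans (m≡m%n+[m/n]*n n m) (+-comm (n % m) _)) dn)

F-pos : ∀ n → 1 ≤ F (suc n)
F-pos zero    = ≤-refl
F-pos (suc n) = ≤-trans (F-pos n) (m≤m+n _ _)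

F-pos′ : ∀ {m} → 1 ≤ m → 1 ≤ F m
F-pos′ {suc m} _ = F-pos m

F-mono : ∀ {m n} → m ≤ n → F m ≤ F n
F-mono z≤n               = z≤n
F-mono {n = suc n} (s≤s z≤n) = F-pos n
F-mono (s≤s (s≤s m≤n))   = +-mono-≤ (F-mono (s≤s m≤n)) (F-mono m≤n)

F-< : ∀ {r m} → r < m → 3 ≤ m → F r < F m
F-< {r} {suc (suc (suc k))} (s≤s r≤) _ = begin-strict
    F r                              ≤⟨ F-mono r≤ ⟩
    F (suc (suc k))                  <⟨ m<m+n _ (F-pos k) ⟩
    F (suc (suc k)) + F (suc k)      ∎
  where open ≤-Reasoning
F-< {m = 1} _ (s≤s ())
F-< {m = 2} _ (s≤s (s≤s ()))

F-∣-F⇒∣ : ∀ {m n} → 3 ≤ m → F m ∣ F n → m ∣ n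
F-∣-F⇒∣ {m@(suc _)} {n} 3≤m h with n % m in eq
... | zero  = m%n≡0⇒n∣m n m eq
... | suc r = contradiction (∣⇒≤ {{>-nonZero (F-pos r)}} Fm∣Fr) (<⇒≱ (F-< r<m 3≤m))
  where
  r<m : suc r < m
  r<m = subst (_< m) eq (m%n<n n m)
  Fm∣Fr : F m ∣ F (suc r)
  Fm∣Fr = subst (λ x → F m ∣ F x) eq (F-∣-% m n ∣-refl h)

F-2* : ∀ m → F (2 * suc m) ≡ F (suc m) * (F (suc m) + 2 * F m)
F-2* m = begin
    F (2 * suc m)                                     ≡⟨ cong F (double (suc m)) ⟩
    F (suc m + suc m)                                 ≡⟨ F-+ (suc m) m ⟩
    (F (suc m) + F m) * F (suc m) + F (suc m) * F m   ≡⟨ factor (F (suc m)) (F m) ⟩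
    F (suc m) * (F (suc m) + 2 * F m)                 ∎
  where
  open ≡-Reasoning
  double : ∀ x → 2 * x ≡ x + x
  double = solve-∀
  factor : ∀ f g → (f + g) * f + f * g ≡ f * (f + 2 * g)
  factor = solve-∀

F-3* : ∀ m → F (3 * suc m) ≡
             F (suc m) * (3 * (F m * F m) + 3 * (F m * F (suc m)) + 2 * (F (suc m) * F (suc m)))
F-3* m = begin
    F (3 * suc m)                                          ≡⟨ cong F (triple m) ⟩
    F (2 * suc m + suc m)                                  ≡⟨ F-+ (2 * suc m) m ⟩
    F (suc (2 * suc m)) * f + F (2 * suc m) * g            ≡⟨ cong₂ (λ u v → u * f + v * g) F[1+2m] (F-2* m) ⟩
    ((f + g) * (f + g) + f * f) * f + f * (f + 2 * g) * g  ≡⟨ factor f g ⟩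
    f * (3 * (g * g) + 3 * (g * f) + 2 * (f * f))          ∎
  where
  open ≡-Reasoning
  f g : ℕ
  f = F (suc m)
  g = F m
  triple : ∀ x → 3 * suc x ≡ 2 * suc x + suc x
  triple = solve-∀
  odd : ∀ x → suc (2 * suc x) ≡ suc x + suc (suc x)
  odd = solve-∀
  F[1+2m] : F (suc (2 * suc m)) ≡ (f + g) * (f + g) + f * f
  F[1+2m] = trans (cong F (odd m)) (F-+ (suc m) (suc m))
  factor : ∀ f g → ((f + g) * (f + g) + f * f) * f + f * (f + 2 * g) * g
                   ≡ f * (3 * (g * g) + 3 * (g * f) + 2 * (f * f))
  factor = solve-∀

F-∣-6 : ∀ {d} → 1 ≤ d → d ≤ 4 → F d ∣ 6
F-∣-6 {1} _ _ = divides 6 refl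
F-∣-6 {2} _ _ = divides 6 refl
F-∣-6 {3} _ _ = divides 3 refl
F-∣-6 {4} _ _ = divides 2 refl
F-∣-6 {suc (suc (suc (suc (suc _))))} _ (s≤s (s≤s (s≤s (s≤s ()))))

at-residue : ∀ m .{{_ : NonZero m}} {P : ℕ → Set} (P? : ∀ r → Dec (P r)) →
             {True (all? (λ (r : Fin m) → P? (toℕ r)))} → ∀ n → P (n % m)
at-residue m {P} P? {ok} n = subst P (toℕ-fromℕ< (m%n<n n m)) (toWitness ok (fromℕ< (m%n<n n m)))

^-monoʳ-∣ : ∀ p {m n} → m ≤ n → p ^ m ∣ p ^ n
^-monoʳ-∣ p {m} {n} m≤n = divides (p ^ (n ∸ m)) (begin
    p ^ n                ≡⟨ cong (p ^_) (sym (m+[n∸m]≡n m≤n)) ⟩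
    p ^ (m + (n ∸ m))    ≡⟨ ^-distribˡ-+-* p m (n ∸ m) ⟩
    p ^ m * p ^ (n ∸ m)  ≡⟨ *-comm (p ^ m) _ ⟩
    p ^ (n ∸ m) * p ^ m  ∎)
  where open ≡-Reasoning

∤-^ : ∀ {p q} k → Prime p → ¬ p ∣ q → ¬ p ∣ q ^ k
∤-^ zero    p-prime _   p∣1 = contradiction (∣1⇒≡1 p∣1) λ { refl → from-no (prime? 1) p-prime }
∤-^ {q = q} (suc k) p-prime p∤q p∣q^[1+k] =
  [ p∤q , ∤-^ k p-prime p∤q ]′ (euclidsLemma q (q ^ k) p-prime p∣q^[1+k])

∤-* : ∀ {p x y} → Prime p → ¬ p ∣ x → ¬ p ∣ y → ¬ p ∣ x * y
∤-* {x = x} {y} p-prime p∤x p∤y p∣xy = [ p∤x , p∤y ]′ (euclidsLemma x y p-prime p∣xy)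

coprime-∣-* : ∀ {m n o} → Coprime m n → m ∣ o → n ∣ o → m * n ∣ o
coprime-∣-* {m} {n} m⊥n (divides k refl) n∣km =
  subst (m * n ∣_) (*-comm m k) (*-monoʳ-∣ m (coprime-divisor n⊥m (subst (n ∣_) (*-comm k m) n∣km)))
  where
  n⊥m : Coprime n m
  n⊥m (i∣n , i∣m) = m⊥n (i∣m , i∣n)

coprime-*ˡ : ∀ {x y z} → Coprime x z → Coprime y z → Coprime (x * y) z
coprime-*ˡ {x} x⊥z y⊥z {i} (i∣xy , i∣z) = y⊥z (coprime-divisor i⊥x i∣xy , i∣z)
  where
  i⊥x : Coprime i x
  i⊥x (j∣i , j∣x) = x⊥z (j∣x , ∣-trans j∣i i∣z)

prime[3] : Prime 3
prime[3] = from-yes (prime? 3)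

2∤3 : ¬ 2 ∣ 3
2∤3 = from-no (2 ∣? 3)

3∤2 : ¬ 3 ∣ 2
3∤2 = from-no (3 ∣? 2)

prime-power-coprime : ∀ {p x} → Prime p → ∀ k → ¬ p ∣ x → Coprime (p ^ k) x
prime-power-coprime p-prime zero    _   (i∣1 , _)         = ∣1⇒≡1 i∣1
prime-power-coprime {p} p-prime (suc k) p∤x {i} (i∣p^[1+k] , i∣x) =
  prime-power-coprime p-prime k p∤x (coprime-divisor i⊥p i∣p^[1+k] , i∣x)
  where
  i⊥p : Coprime i p
  i⊥p (j∣i , j∣p) with prime⇒irreducible p-prime j∣p
  ... | inj₁ j≡1 = j≡1
  ... | inj₂ refl = contradiction (∣-trans j∣i i∣x) p∤x

2^⊥3^ : ∀ a b → Coprime (2 ^ a) (3 ^ b)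
2^⊥3^ a b = prime-power-coprime prime[2] a (∤-^ b prime[2] 2∤3)

2⊥3 : Coprime 2 3
2⊥3 = from-yes (coprime? 2 3)

3⊥2 : Coprime 3 2
3⊥2 = from-yes (coprime? 3 2)

3⊥4 : Coprime 3 4
3⊥4 = from-yes (coprime? 3 4)

4⊥3 : Coprime 4 3
4⊥3 = from-yes (coprime? 4 3)

lcm-pos : ∀ {x y} → 1 ≤ x → 1 ≤ y → 1 ≤ lcm x y
lcm-pos {x} {y} 1≤x 1≤y with lcm x y in eq
... | suc _ = s≤s z≤n
... | zero  = contradiction (subst (1 ≤_) xy≡0 (*-mono-≤ 1≤x 1≤y)) λ ()
  where
  xy≡0 : x * y ≡ 0
  xy≡0 = trans (sym (gcd*lcm x y)) (trans (cong (gcd x y *_) eq) (*-zeroʳ (gcd x y)))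

∣-+-close⇒≡ : ∀ {d n a b} → a ≤ b → b ∸ a < d → d ∣ n + a → d ∣ n + b → a ≡ b
∣-+-close⇒≡ {d} {n} {a} {b} a≤b gap<d d∣a d∣b with b ∸ a in eq
... | zero  = ≤-antisym a≤b (m∸n≡0⇒m≤n eq)
... | suc g = contradiction (∣⇒≤ d∣gap) (<⇒≱ gap<d)
  where
  n+b≡ : n + b ≡ n + a + (b ∸ a)
  n+b≡ = sym (trans (+-assoc n a (b ∸ a)) (cong (n +_) (m+[n∸m]≡n a≤b)))
  d∣gap : d ∣ suc g
  d∣gap = subst (d ∣_) eq (∣m+n∣m⇒∣n (subst (d ∣_) n+b≡ d∣b) d∣a)

∣-ahead : ∀ {d} n a c → d ∣ n + a → d ∣ c → d ∣ n + (a + c)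
∣-ahead {d} n a c d∣n+a d∣c = subst (d ∣_) (+-assoc n a c) (∣m∣n⇒∣m+n d∣n+a d∣c)

∤-ahead : ∀ {d} n a c → d ∣ n + a → ¬ d ∣ c → ¬ d ∣ n + (a + c)
∤-ahead {d} n a c d∣n+a d∤c d∣ =
  d∤c (∣m+n∣m⇒∣n (subst (d ∣_) (sym (+-assoc n a c)) d∣) d∣n+a)

∤-behind : ∀ {d} n a c → d ∣ n + (a + c) → ¬ d ∣ c → ¬ d ∣ n + a
∤-behind {d} n a c d∣n+a+c d∤c d∣ =
  d∤c (∣m+n∣m⇒∣n (subst (d ∣_) (sym (+-assoc n a c)) d∣n+a+c) d∣)

n+k≡[n/m]*m+[n%m+k] : ∀ m n k .{{_ : NonZero m}} → n + k ≡ n / m * m + (n % m + k)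
n+k≡[n/m]*m+[n%m+k] m n k = trans (cong (_+ k) (m≡m%n+[m/n]*n n m)) (swap (n % m) (n / m * m) k)
  where
  swap : ∀ a b c → a + b + c ≡ b + (a + c)
  swap = solve-∀

∣-%-+ : ∀ {d} m n k .{{_ : NonZero m}} → d ∣ m → d ∣ n % m + k → d ∣ n + k
∣-%-+ {d} m n k d∣m d∣r+k =
  subst (d ∣_) (sym (n+k≡[n/m]*m+[n%m+k] m n k)) (∣m∣n⇒∣m+n (∣n⇒∣m*n (n / m) d∣m) d∣r+k)

∣-+-% : ∀ {d} m n k .{{_ : NonZero m}} → d ∣ m → d ∣ n + k → d ∣ n % m + k
∣-+-% {d} m n k d∣m d∣n+k =
  ∣m+n∣m⇒∣n (subst (d ∣_) (n+k≡[n/m]*m+[n%m+k] m n k) d∣n+k) (∣n⇒∣m*n (n / m) d∣m)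

mod-2-cases : ∀ n → 2 ∣ n ⊎ 2 ∣ n + 1
mod-2-cases n with at-residue 2 (λ r → 2 ∣? r ⊎-dec 2 ∣? r + 1) n
... | inj₁ 2∣r   = inj₁ (∣n∣m%n⇒∣m ∣-refl 2∣r)
... | inj₂ 2∣r+1 = inj₂ (∣-%-+ 2 n 1 ∣-refl 2∣r+1)

mod-3-cases : ∀ n → 3 ∣ n ⊎ 3 ∣ n + 1 ⊎ 3 ∣ n + 2
mod-3-cases n with at-residue 3 (λ r → 3 ∣? r ⊎-dec 3 ∣? r + 1 ⊎-dec 3 ∣? r + 2) n
... | inj₁ 3∣r         = inj₁ (∣n∣m%n⇒∣m ∣-refl 3∣r)
... | inj₂ (inj₁ 3∣r+1) = inj₂ (inj₁ (∣-%-+ 3 n 1 ∣-refl 3∣r+1))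
... | inj₂ (inj₂ 3∣r+2) = inj₂ (inj₂ (∣-%-+ 3 n 2 ∣-refl 3∣r+2))

mod-4-cases : ∀ n → 4 ∣ n ⊎ 4 ∣ n + 1 ⊎ 4 ∣ n + 2 ⊎ 4 ∣ n + 3
mod-4-cases n
  with at-residue 4 (λ r → 4 ∣? r ⊎-dec 4 ∣? r + 1 ⊎-dec 4 ∣? r + 2 ⊎-dec 4 ∣? r + 3) n
... | inj₁ 4∣r                 = inj₁ (∣n∣m%n⇒∣m ∣-refl 4∣r)
... | inj₂ (inj₁ 4∣r+1)         = inj₂ (inj₁ (∣-%-+ 4 n 1 ∣-refl 4∣r+1))
... | inj₂ (inj₂ (inj₁ 4∣r+2))  = inj₂ (inj₂ (inj₁ (∣-%-+ 4 n 2 ∣-refl 4∣r+2)))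
... | inj₂ (inj₂ (inj₂ 4∣r+3))  = inj₂ (inj₂ (inj₂ (∣-%-+ 4 n 3 ∣-refl 4∣r+3)))

∣6⇒≡1 : ∀ {t} → t ∣ 6 → ¬ 2 ∣ t → ¬ 3 ∣ t → t ≡ 1
∣6⇒≡1 {t} t∣6 2∤t 3∤t
  with subst (λ r → ¬ r ∣ 6 ⊎ 2 ∣ r ⊎ 3 ∣ r ⊎ r ≡ 1) (m<n⇒m%n≡m (s≤s (∣⇒≤ t∣6)))
             (at-residue 7 (λ r → ¬? (r ∣? 6) ⊎-dec 2 ∣? r ⊎-dec 3 ∣? r ⊎-dec r ≟ 1) t)
... | inj₁ t∤6                = contradiction t∣6 t∤6
... | inj₂ (inj₁ 2∣t)         = contradiction 2∣t 2∤t
... | inj₂ (inj₂ (inj₁ 3∣t))  = contradiction 3∣t 3∤t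
... | inj₂ (inj₂ (inj₂ t≡1))  = t≡1

-- p-adic valuations

record Val (p x e : ℕ) : Set where
  constructor val
  field
    pow-∣ : p ^ e ∣ x
    pow-∤ : ¬ p ^ suc e ∣ x
open Val public

Val-≡ : ∀ {p x e f} → e ≡ f → Val p x e → Val p x f
Val-≡ {p} {x} = subst (Val p x)

Val-+ : ∀ {p x y e} → Val p x e → p ^ suc e ∣ y → Val p (x + y) e
Val-+ {p} {x} {y} {e} v p^[1+e]∣y = val
  (∣m∣n⇒∣m+n (pow-∣ v) (∣-trans (^-monoʳ-∣ p (n≤1+n e)) p^[1+e]∣y))
  λ p^[1+e]∣x+y → pow-∤ v
      (∣m+n∣m⇒∣n (subst (p ^ suc e ∣_) (+-comm x y) p^[1+e]∣x+y) p^[1+e]∣y)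

module _ {p : ℕ} (p-prime : Prime p) where
  private instance
    p≢0 : NonZero p
    p≢0 = prime⇒nonZero p-prime

  Val-intro : ∀ {x e u} → x ≡ p ^ e * u → ¬ p ∣ u → Val p x e
  Val-intro {e = e} {u} refl p∤u = val (m∣m*n u) λ p^[1+e]∣x →
    p∤u (*-cancelˡ-∣ (p ^ e) {{m^n≢0 p e}} (subst (_∣ p ^ e * u) (*-comm p (p ^ e)) p^[1+e]∣x))

  Val-elim : ∀ {x e} → Val p x e → ∃ λ u → x ≡ p ^ e * u × ¬ p ∣ u
  Val-elim {e = e} (val (divides u eq) ∤) = u , trans eq (*-comm u (p ^ e)) , p∤u
    where
    p∤u : ¬ p ∣ u
    p∤u (divides v refl) = ∤ (divides v (trans eq (*-assoc v p (p ^ e))))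

  Val-^ : ∀ e → Val p (p ^ e) e
  Val-^ e = Val-intro (sym (*-identityʳ (p ^ e))) λ p∣1 →
    from-no (prime? 1) (subst Prime (∣1⇒≡1 p∣1) p-prime)

  Val-0 : ∀ {x} → ¬ p ∣ x → Val p x 0
  Val-0 {x} p∤x = val (1∣ x) λ p∣x → p∤x (subst (_∣ x) (*-identityʳ p) p∣x)

  Val-≤ : ∀ {x k e} → p ^ k ∣ x → Val p x e → k ≤ e
  Val-≤ {k = k} {e} p^k∣x v with k ≤? e
  ... | yes k≤e = k≤e
  ... | no  k≰e = contradiction (∣-trans (^-monoʳ-∣ p (≰⇒> k≰e)) p^k∣x) (pow-∤ v)

  Val-< : ∀ {x k e} → ¬ p ^ k ∣ x → Val p x e → e < k
  Val-< {k = k} {e} p^k∤x v with e <? k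
  ... | yes e<k = e<k
  ... | no  e≮k = contradiction (∣-trans (^-monoʳ-∣ p (≮⇒≥ e≮k)) (pow-∣ v)) p^k∤x

  Val-unique : ∀ {x e f} → Val p x e → Val p x f → e ≡ f
  Val-unique v w = ≤-antisym (Val-≤ (pow-∣ v) w) (Val-≤ (pow-∣ w) v)

  Val-∣ : ∀ {x k e} → k ≤ e → Val p x e → p ^ k ∣ x
  Val-∣ k≤e v = ∣-trans (^-monoʳ-∣ p k≤e) (pow-∣ v)

  Val-* : ∀ {x y e f} → Val p x e → Val p y f → Val p (x * y) (e + f)
  Val-* {e = e} {f} v w with Val-elim v | Val-elim w
  ... | u , refl , p∤u | u' , refl , p∤u' =
    Val-intro (regroup {p ^ e} {p ^ f} {u} {u'} (^-distribˡ-+-* p e f))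
      λ p∣uu' → [ p∤u , p∤u' ]′ (euclidsLemma u u' p-prime p∣uu')
    where
    regroup : ∀ {a b c d ab} → ab ≡ a * b → a * c * (b * d) ≡ ab * (c * d)
    regroup {a} {b} {c} {d} refl = interchange a b c d
      where
      interchange : ∀ a b c d → a * c * (b * d) ≡ a * b * (c * d)
      interchange = solve-∀

  Val-p* : ∀ {x e} → Val p x e → Val p (p * x) (suc e)
  Val-p* {e = e} v with Val-elim v
  ... | u , refl , p∤u = Val-intro (sym (*-assoc p (p ^ e) u)) p∤u

  Val-÷ : ∀ {x e} → Val p x (suc e) → ∃ λ y → x ≡ p * y × Val p y e
  Val-÷ {e = e} v with Val-elim v
  ... | u , refl , p∤u = p ^ e * u , *-assoc p (p ^ e) u , Val-intro refl p∤u

  val-exists : ∀ {x} → 1 ≤ x → ∃ (Val p x)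
  val-exists {x} = go x ≤-refl
    where
    go : ∀ fuel {x} → x ≤ fuel → 1 ≤ x → ∃ (Val p x)
    go zero       x≤0 1≤x = contradiction (≤-trans 1≤x x≤0) λ ()
    go (suc fuel) {x} x≤ 1≤x with p ∣? x
    ... | no  p∤x = 0 , Val-0 p∤x
    ... | yes (divides zero    refl) = contradiction 1≤x λ ()
    ... | yes (divides q@(suc _) refl) =
      map suc step (go fuel (≤-pred (≤-trans q<qp x≤)) (s≤s z≤n))
      where
      step : ∀ {e} → Val p q e → Val p (q * p) (suc e)
      step {e} v = subst (λ y → Val p y (suc e)) (*-comm p q) (Val-p* v)
      q<qp : q < q * p
      q<qp = m<m*n q p (nonTrivial⇒n>1 p {{prime⇒nonTrivial p-prime}})

  ¬pow-∣-lcm : ∀ {x y k} → 1 ≤ x → 1 ≤ y → ¬ p ^ k ∣ x → ¬ p ^ k ∣ y → ¬ p ^ k ∣ lcm x y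
  ¬pow-∣-lcm {k = k} 1≤x 1≤y p^k∤x p^k∤y p^k∣l with val-exists 1≤x | val-exists 1≤y
  ... | e , vx | f , vy with Val-elim vx | Val-elim vy
  ... | u , refl , p∤u | u' , refl , p∤u' =
    <⇒≱ (⊔-lub (Val-< p^k∤x vx) (Val-< p^k∤y vy))
        (Val-≤ {k = k} (∣-trans p^k∣l (lcm-least x∣w y∣w)) vw)
    where
    w : ℕ
    w = p ^ (e ⊔ f) * (u * u')
    vw : Val p w (e ⊔ f)
    vw = Val-intro refl λ p∣uu' → [ p∤u , p∤u' ]′ (euclidsLemma u u' p-prime p∣uu')
    x∣w : p ^ e * u ∣ w
    x∣w = *-pres-∣ (^-monoʳ-∣ p (m≤m⊔n e f)) (m∣m*n u')
    y∣w : p ^ f * u' ∣ w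
    y∣w = *-pres-∣ (^-monoʳ-∣ p (m≤n⊔m e f)) (n∣m*n u)

-- 2- and 3-adic valuations of Fibonacci numbers

2∤F : ∀ {m} → ¬ 3 ∣ m → ¬ 2 ∣ F m
2∤F {m} 3∤m 2∣F = refute (at-residue 3 (λ r → 3 ∣? r ⊎-dec ¬? (2 ∣? F r)) m)
  where
  refute : 3 ∣ m % 3 ⊎ ¬ 2 ∣ F (m % 3) → ⊥
  refute (inj₁ 3∣r)  = 3∤m (∣n∣m%n⇒∣m ∣-refl 3∣r)
  refute (inj₂ 2∤Fr) = 2∤Fr (F-∣-% 3 m (divides 1 refl) 2∣F)

4∤F : ∀ {m} → 3 ∣ m → ¬ 2 ∣ m → ¬ 4 ∣ F m
4∤F {m} 3∣m 2∤m 4∣F =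
  refute (at-residue 6 (λ r → ¬? (3 ∣? r) ⊎-dec 2 ∣? r ⊎-dec ¬? (4 ∣? F r)) m)
  where
  refute : ¬ 3 ∣ m % 6 ⊎ 2 ∣ m % 6 ⊎ ¬ 4 ∣ F (m % 6) → ⊥
  refute (inj₁ 3∤r)         = 3∤r (%-presˡ-∣ 3∣m (divides 2 refl))
  refute (inj₂ (inj₁ 2∣r))  = 2∤m (∣n∣m%n⇒∣m (divides 3 refl) 2∣r)
  refute (inj₂ (inj₂ 4∤Fr)) = 4∤Fr (F-∣-% 6 m (divides 2 refl) 4∣F)

16∤F : ∀ {m} → 6 ∣ m → ¬ 4 ∣ m → ¬ 16 ∣ F m
16∤F {m} 6∣m 4∤m 16∣F =
  refute (at-residue 12 (λ r → ¬? (6 ∣? r) ⊎-dec 4 ∣? r ⊎-dec ¬? (16 ∣? F r)) m)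
  where
  refute : ¬ 6 ∣ m % 12 ⊎ 4 ∣ m % 12 ⊎ ¬ 16 ∣ F (m % 12) → ⊥
  refute (inj₁ 6∤r)          = 6∤r (%-presˡ-∣ 6∣m (divides 2 refl))
  refute (inj₂ (inj₁ 4∣r))   = 4∤m (∣n∣m%n⇒∣m (divides 3 refl) 4∣r)
  refute (inj₂ (inj₂ 16∤Fr)) = 16∤Fr (F-∣-% 12 m (divides 9 refl) 16∣F)

3∤F : ∀ {m} → ¬ 4 ∣ m → ¬ 3 ∣ F m
3∤F {m} 4∤m 3∣F = refute (at-residue 4 (λ r → 4 ∣? r ⊎-dec ¬? (3 ∣? F r)) m)
  where
  refute : 4 ∣ m % 4 ⊎ ¬ 3 ∣ F (m % 4) → ⊥
  refute (inj₁ 4∣r)  = 4∤m (∣n∣m%n⇒∣m ∣-refl 4∣r)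
  refute (inj₂ 3∤Fr) = 3∤Fr (F-∣-% 4 m (divides 1 refl) 3∣F)

9∤F : ∀ {m} → 4 ∣ m → ¬ 3 ∣ m → ¬ 9 ∣ F m
9∤F {m} 4∣m 3∤m 9∣F =
  refute (at-residue 12 (λ r → ¬? (4 ∣? r) ⊎-dec 3 ∣? r ⊎-dec ¬? (9 ∣? F r)) m)
  where
  refute : ¬ 4 ∣ m % 12 ⊎ 3 ∣ m % 12 ⊎ ¬ 9 ∣ F (m % 12) → ⊥
  refute (inj₁ 4∤r)         = 4∤r (%-presˡ-∣ 4∣m (divides 3 refl))
  refute (inj₂ (inj₁ 3∣r))  = 3∤m (∣n∣m%n⇒∣m (divides 4 refl) 3∣r)
  refute (inj₂ (inj₂ 9∤Fr)) = 9∤Fr (F-∣-% 12 m (divides 16 refl) 9∣F)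

Val₂F-0 : ∀ {m} → ¬ 3 ∣ m → Val 2 (F m) 0
Val₂F-0 3∤m = Val-0 prime[2] (2∤F 3∤m)

Val₂F-1 : ∀ {m} → 3 ∣ m → ¬ 2 ∣ m → Val 2 (F m) 1
Val₂F-1 3∣m 2∤m = val (F-∣-F 3∣m) (4∤F 3∣m 2∤m)

-- F (2 m) = F m (F m + 2 F (m - 1)) and, once 4 ∣ F m, the second factor is twice an odd number.
Val₂F-even : ∀ j {m} → 3 ∣ m → Val 2 m (suc j) → Val 2 (F m) (suc j + 2)
Val₂F-even zero {m} 3∣m v = val (F-∣-F 6∣m) (16∤F 6∣m (pow-∤ v))
  where
  6∣m : 6 ∣ m
  6∣m = coprime-∣-* 2⊥3 (pow-∣ v) 3∣m
Val₂F-even (suc j) 3∣m v with Val-÷ prime[2] v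
... | zero     , refl , v' = contradiction (_ ∣0) (pow-∤ v')
... | suc m₀ , refl , v' =
  subst (λ x → Val 2 x (suc (suc j) + 2)) (sym (F-2* m₀))
    (subst (Val 2 _) (+-comm (suc j + 2) 1) (Val-* prime[2] F[1+m₀]-val cofactor-val))
  where
  3∣1+m₀ : 3 ∣ suc m₀
  3∣1+m₀ = coprime-divisor 3⊥2 3∣m
  3∤m₀ : ¬ 3 ∣ m₀
  3∤m₀ 3∣m₀ = from-no (3 ∣? 1) (∣m+n∣m⇒∣n (subst (3 ∣_) (+-comm 1 m₀) 3∣1+m₀) 3∣m₀)
  F[1+m₀]-val : Val 2 (F (suc m₀)) (suc j + 2)
  F[1+m₀]-val = Val₂F-even j 3∣1+m₀ v'
  cofactor-val : Val 2 (F (suc m₀) + 2 * F m₀) 1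
  cofactor-val = subst (λ x → Val 2 x 1) (+-comm (2 * F m₀) (F (suc m₀)))
    (Val-+ (Val-p* prime[2] (Val₂F-0 3∤m₀)) (Val-∣ prime[2] (m≤n+m 2 (suc j)) F[1+m₀]-val))

Val₂F-6∣ : ∀ {m v} → 6 ∣ m → Val 2 m v → Val 2 (F m) (v + 2)
Val₂F-6∣ {v = zero}  6∣m v = contradiction (∣-trans (divides 3 refl) 6∣m) (pow-∤ v)
Val₂F-6∣ {v = suc j} 6∣m v = Val₂F-even j (∣-trans (divides 2 refl) 6∣m) v

Val₂F-≤ : ∀ {m v f} → Val 2 m v → Val 2 (F m) f → f ≤ v + 2
Val₂F-≤ {m} {v} vm vF with 3 ∣? m | 2 ∣? m
... | no 3∤m  | _       rewrite Val-unique prime[2] vF (Val₂F-0 3∤m) = z≤n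
... | yes 3∣m | no 2∤m  rewrite Val-unique prime[2] vF (Val₂F-1 3∣m 2∤m) =
  ≤-trans (s≤s z≤n) (m≤n+m 2 v)
... | yes 3∣m | yes 2∣m =
  ≤-reflexive (Val-unique prime[2] vF (Val₂F-6∣ (coprime-∣-* 2⊥3 2∣m 3∣m) vm))

Val₃F-0 : ∀ {m} → ¬ 4 ∣ m → Val 3 (F m) 0
Val₃F-0 4∤m = Val-0 prime[3] (3∤F 4∤m)

-- F (3 m) = F m · Q with Q ≡ 3 F (m - 1)² (mod 9) once 3 ∣ F m, so 3 exactly divides Q.
Val₃F-4∣ : ∀ {m e} → 4 ∣ m → Val 3 m e → Val 3 (F m) (e + 1)
Val₃F-4∣ {e = zero}  4∣m v = val (F-∣-F 4∣m) (9∤F 4∣m (pow-∤ v))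
Val₃F-4∣ {e = suc e} 4∣m v with Val-÷ prime[3] v
... | zero     , refl , v' = contradiction (_ ∣0) (pow-∤ v')
... | suc m₀ , refl , v' =
  subst₂ (Val 3) (sym (F-3* m₀)) (+-comm (e + 1) 1) (Val-* prime[3] F[1+m₀]-val cofactor-val)
  where
  f g : ℕ
  f = F (suc m₀)
  g = F m₀
  4∣1+m₀ : 4 ∣ suc m₀
  4∣1+m₀ = coprime-divisor 4⊥3 4∣m
  3∤g : ¬ 3 ∣ g
  3∤g = 3∤F λ 4∣m₀ → from-no (4 ∣? 1) (∣m+n∣m⇒∣n (subst (4 ∣_) (+-comm 1 m₀) 4∣1+m₀) 4∣m₀)
  F[1+m₀]-val : Val 3 f (e + 1)
  F[1+m₀]-val = Val₃F-4∣ 4∣1+m₀ v'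
  3∣f : 3 ∣ f
  3∣f = Val-∣ prime[3] (m≤n+m 1 e) F[1+m₀]-val
  cofactor-val : Val 3 (3 * (g * g) + 3 * (g * f) + 2 * (f * f)) 1
  cofactor-val = Val-+ (Val-+ (Val-p* prime[3] (Val-0 prime[3] 3∤g²))
                              (*-monoʳ-∣ 3 (∣n⇒∣m*n g 3∣f)))
                       (∣n⇒∣m*n 2 (*-pres-∣ 3∣f 3∣f))
    where
    3∤g² : ¬ 3 ∣ g * g
    3∤g² 3∣g² = [ 3∤g , 3∤g ]′ (euclidsLemma g g prime[3] 3∣g²)

Val₃F-≤ : ∀ {m v f} → Val 3 m v → Val 3 (F m) f → f ≤ v + 1
Val₃F-≤ {m} vm vF with 4 ∣? m
... | no 4∤m  rewrite Val-unique prime[3] vF (Val₃F-0 4∤m) = z≤n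
... | yes 4∣m = ≤-reflexive (Val-unique prime[3] vF (Val₃F-4∣ 4∣m vm))

-- The window n, n + 1, …, n + 4

3≤3+ : ∀ {m} → 3 ≤ 3 + m
3≤3+ = s≤s (s≤s (s≤s z≤n))

window-pos : ∀ {n} → 1 ≤ n → ∀ (i : Fin 5) → 1 ≤ n + toℕ i
window-pos {n} 1≤n i = ≤-trans 1≤n (m≤m+n n (toℕ i))

lcm5-∣ : ∀ n (i : Fin 5) → n + toℕ i ∣ lcm5 n
lcm5-∣ n 0F = subst (_∣ lcm5 n) (sym (+-identityʳ n)) (m∣lcm[m,n] n _)
lcm5-∣ n 1F = ∣-trans (m∣lcm[m,n] (n + 1) _) (n∣lcm[m,n] n _)
lcm5-∣ n 2F = ∣-trans (m∣lcm[m,n] (n + 2) _) (∣-trans (n∣lcm[m,n] (n + 1) _) (n∣lcm[m,n] n _))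
lcm5-∣ n 3F = ∣-trans (m∣lcm[m,n] (n + 3) _) (∣-trans (n∣lcm[m,n] (n + 2) _)
                (∣-trans (n∣lcm[m,n] (n + 1) _) (n∣lcm[m,n] n _)))
lcm5-∣ n 4F = ∣-trans (n∣lcm[m,n] (n + 3) _) (∣-trans (n∣lcm[m,n] (n + 2) _)
                (∣-trans (n∣lcm[m,n] (n + 1) _) (n∣lcm[m,n] n _)))

lcm5-least : ∀ {n m} → (∀ (i : Fin 5) → n + toℕ i ∣ m) → lcm5 n ∣ m
lcm5-least {n} h = lcm-least (subst (_∣ _) (+-identityʳ n) (h 0F))
  (lcm-least (h 1F) (lcm-least (h 2F) (lcm-least (h 3F) (h 4F))))

module _ {n : ℕ} (1≤n : 1 ≤ n) where
  private
    pos : ∀ (i : Fin 5) → 1 ≤ n + toℕ i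
    pos = window-pos 1≤n
    pos₃₄ : 1 ≤ lcm (n + 3) (n + 4)
    pos₃₄ = lcm-pos (pos 3F) (pos 4F)
    pos₂₃₄ : 1 ≤ lcm (n + 2) (lcm (n + 3) (n + 4))
    pos₂₃₄ = lcm-pos (pos 2F) pos₃₄
    pos₁₂₃₄ : 1 ≤ lcm (n + 1) (lcm (n + 2) (lcm (n + 3) (n + 4)))
    pos₁₂₃₄ = lcm-pos (pos 1F) pos₂₃₄

  lcm5-pos : 1 ≤ lcm5 n
  lcm5-pos = lcm-pos 1≤n pos₁₂₃₄

  prod5-pos : 1 ≤ prod5 n
  prod5-pos = *-mono-≤ (*-mono-≤ (*-mono-≤ (*-mono-≤ (F-pos′ 1≤n)
    (F-pos′ (pos 1F))) (F-pos′ (pos 2F))) (F-pos′ (pos 3F))) (F-pos′ (pos 4F))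

  ¬pow-∣-lcm5 : ∀ {p k} → Prime p → (∀ (i : Fin 5) → ¬ p ^ k ∣ n + toℕ i) → ¬ p ^ k ∣ lcm5 n
  ¬pow-∣-lcm5 {p} {k} p-prime h =
    ∤lcm 1≤n pos₁₂₃₄ (subst (λ x → ¬ p ^ k ∣ x) (+-identityʳ n) (h 0F))
      (∤lcm (pos 1F) pos₂₃₄ (h 1F) (∤lcm (pos 2F) pos₃₄ (h 2F) (∤lcm (pos 3F) (pos 4F) (h 3F) (h 4F))))
    where
    ∤lcm : ∀ {x y} → 1 ≤ x → 1 ≤ y → ¬ p ^ k ∣ x → ¬ p ^ k ∣ y → ¬ p ^ k ∣ lcm x y
    ∤lcm = ¬pow-∣-lcm p-prime {k = k}

F-∣-prod5 : ∀ n (i : Fin 5) → F (n + toℕ i) ∣ prod5 n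
F-∣-prod5 n 0F = subst (λ m → F m ∣ prod5 n) (sym (+-identityʳ n))
  (∣m⇒∣m*n _ (∣m⇒∣m*n _ (∣m⇒∣m*n _ (m∣m*n (F (n + 1))))))
F-∣-prod5 n 1F = ∣m⇒∣m*n _ (∣m⇒∣m*n _ (∣m⇒∣m*n _ (n∣m*n (F n))))
F-∣-prod5 n 2F = ∣m⇒∣m*n _ (∣m⇒∣m*n _ (n∣m*n (F n * F (n + 1))))
F-∣-prod5 n 3F = ∣m⇒∣m*n _ (n∣m*n (F n * F (n + 1) * F (n + 2)))
F-∣-prod5 n 4F = n∣m*n (F n * F (n + 1) * F (n + 2) * F (n + 3))

Val-prod5 : ∀ {p} n {f₀ f₁ f₂ f₃ f₄} → Prime p →
            Val p (F n) f₀ → Val p (F (n + 1)) f₁ → Val p (F (n + 2)) f₂ →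
            Val p (F (n + 3)) f₃ → Val p (F (n + 4)) f₄ →
            Val p (prod5 n) (f₀ + f₁ + f₂ + f₃ + f₄)
Val-prod5 n pr v₀ v₁ v₂ v₃ v₄ = Val-* pr (Val-* pr (Val-* pr (Val-* pr v₀ v₁) v₂) v₃) v₄

window-unique : ∀ {d n} {i j : Fin 5} → 5 ≤ d → d ∣ n + toℕ i → d ∣ n + toℕ j → i ≡ j
window-unique {d} {n} {i} {j} 5≤d d∣i d∣j =
  [ (λ i≤j → toℕ-injective (∣-+-close⇒≡ i≤j (close j {toℕ i}) d∣i d∣j))
  , (λ j≤i → sym (toℕ-injective (∣-+-close⇒≡ j≤i (close i {toℕ j}) d∣j d∣i)))
  ]′ (≤-total (toℕ i) (toℕ j))
  where
  close : ∀ (b : Fin 5) {a} → toℕ b ∸ a < d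
  close b {a} = <-≤-trans (≤-<-trans (m∸n≤m (toℕ b) a) (toℕ<n b)) 5≤d

window-multiple : ∀ d .{{_ : NonZero d}} → d ≤ 5 → ∀ n → ∃ λ (i : Fin 5) → d ∣ n + toℕ i
window-multiple d d≤5 n with n % d in eq
... | zero  = 0F , subst (d ∣_) (sym (+-identityʳ n)) (m%n≡0⇒n∣m n d eq)
... | suc r = fromℕ< gap<5 , subst (λ g → d ∣ n + g) (sym (toℕ-fromℕ< gap<5)) d∣n+gap
  where
  q : ℕ
  q = n / d
  r<d : suc r < d
  r<d = subst (_< d) eq (m%n<n n d)
  gap<5 : d ∸ suc r < 5
  gap<5 = <-≤-trans (∸-monoʳ-< (s≤s z≤n) (<⇒≤ r<d)) d≤5
  n+gap≡ : n + (d ∸ suc r) ≡ q * d + d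
  n+gap≡ = begin
    n + (d ∸ suc r)                  ≡⟨ cong (λ m → m + (d ∸ suc r)) (m≡m%n+[m/n]*n n d) ⟩
    n % d + q * d + (d ∸ suc r)      ≡⟨ cong (λ m → m + q * d + (d ∸ suc r)) eq ⟩
    suc r + q * d + (d ∸ suc r)      ≡⟨ swap (suc r) (q * d) (d ∸ suc r) ⟩
    q * d + (suc r + (d ∸ suc r))    ≡⟨ cong (q * d +_) (m+[n∸m]≡n (<⇒≤ r<d)) ⟩
    q * d + d                        ∎
    where
    open ≡-Reasoning
    swap : ∀ a b c → a + b + c ≡ b + (a + c)
    swap = solve-∀
  d∣n+gap : d ∣ n + (d ∸ suc r)
  d∣n+gap = subst (d ∣_) (sym n+gap≡) (∣m∣n⇒∣m+n (n∣m*n q) ∣-refl)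

window-∣-of-large : ∀ {n j} → 1 ≤ n → (∀ (i : Fin 5) → 3 ≤ n + toℕ i → n + toℕ i ∣ j) →
                    ∀ (i : Fin 5) → n + toℕ i ∣ j
window-∣-of-large {suc (suc (suc n))} _ large i = large i 3≤3+
window-∣-of-large {1} _ large 0F               = 1∣ _
window-∣-of-large {1} _ large 1F               = ∣-trans (divides 2 refl) (large 3F 3≤3+)
window-∣-of-large {1} _ large i@(fsuc (fsuc _)) = large i 3≤3+
window-∣-of-large {2} _ large 0F               = ∣-trans (divides 2 refl) (large 2F 3≤3+)
window-∣-of-large {2} _ large i@(fsuc _)       = large i 3≤3+

prod5-∣-F⇒lcm5-∣ : ∀ {n j} → 1 ≤ n → prod5 n ∣ F j → lcm5 n ∣ j
prod5-∣-F⇒lcm5-∣ {n} 1≤n b∣Fj =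
  lcm5-least (window-∣-of-large 1≤n λ i 3≤ → F-∣-F⇒∣ 3≤ (∣-trans (F-∣-prod5 n i) b∣Fj))

-- Coprime-to-6 parts

record Split6 (x : ℕ) : Set where
  constructor split6
  field
    e₂ e₃ r : ℕ
    x≡    : x ≡ 2 ^ e₂ * 3 ^ e₃ * r
    2∤r   : ¬ 2 ∣ r
    3∤r   : ¬ 3 ∣ r

split6-exists : ∀ {x} → 1 ≤ x → Split6 x
split6-exists 1≤x with val-exists prime[2] 1≤x
... | e₂ , v₂ with Val-elim prime[2] v₂
... | y , refl , 2∤y with val-exists prime[3] {y} (n≢0⇒n>0 λ { refl → 2∤y (2 ∣0) })
... | e₃ , v₃ with Val-elim prime[3] v₃
... | r , refl , 3∤r =
  split6 e₂ e₃ r (sym (*-assoc (2 ^ e₂) (3 ^ e₃) r)) (λ 2∣r → 2∤y (∣n⇒∣m*n (3 ^ e₃) 2∣r)) 3∤r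

Split6-* : ∀ {x y} → Split6 x → Split6 y → Split6 (x * y)
Split6-* {x} {y} s t = split6 (e₂ s + e₂ t) (e₃ s + e₃ t) (r s * r t) xy≡
  (∤-* prime[2] (2∤r s) (2∤r t)) (∤-* prime[3] (3∤r s) (3∤r t))
  where
  open Split6
  interchange : ∀ P Q R P' Q' S → P * Q * R * (P' * Q' * S) ≡ P * P' * (Q * Q') * (R * S)
  interchange = solve-∀
  xy≡ : x * y ≡ 2 ^ (e₂ s + e₂ t) * 3 ^ (e₃ s + e₃ t) * (r s * r t)
  xy≡ = begin
    x * y
      ≡⟨ cong₂ _*_ (x≡ s) (x≡ t) ⟩
    2 ^ e₂ s * 3 ^ e₃ s * r s * (2 ^ e₂ t * 3 ^ e₃ t * r t)
      ≡⟨ interchange (2 ^ e₂ s) (3 ^ e₃ s) (r s) (2 ^ e₂ t) (3 ^ e₃ t) (r t) ⟩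
    2 ^ e₂ s * 2 ^ e₂ t * (3 ^ e₃ s * 3 ^ e₃ t) * (r s * r t)
      ≡⟨ sym (cong₂ (λ P Q → P * Q * (r s * r t))
                    (^-distribˡ-+-* 2 (e₂ s) (e₂ t)) (^-distribˡ-+-* 3 (e₃ s) (e₃ t))) ⟩
    2 ^ (e₂ s + e₂ t) * 3 ^ (e₃ s + e₃ t) * (r s * r t)
      ∎
    where open ≡-Reasoning

module _ {x} (s : Split6 x) where
  open Split6 s

  Split6-val₂ : Val 2 x e₂
  Split6-val₂ = Val-intro prime[2] (trans x≡ (*-assoc (2 ^ e₂) (3 ^ e₃) r))
    (∤-* prime[2] (∤-^ e₃ prime[2] 2∤3) 2∤r)

  Split6-val₃ : Val 3 x e₃
  Split6-val₃ = Val-intro prime[3] (trans x≡ (swap (2 ^ e₂) (3 ^ e₃) r))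
    (∤-* prime[3] (∤-^ e₂ prime[3] 3∤2) 3∤r)
    where
    swap : ∀ P Q R → P * Q * R ≡ Q * (P * R)
    swap = solve-∀

  Split6-r∣ : r ∣ x
  Split6-r∣ = subst (r ∣_) (sym x≡) (n∣m*n (2 ^ e₂ * 3 ^ e₃))

window-coprime : ∀ {n x y} (i j : Fin 5) → {True (toℕ i <? toℕ j)} →
                 x ∣ F (n + toℕ i) → y ∣ F (n + toℕ j) → ¬ 2 ∣ x → ¬ 3 ∣ x → Coprime x y
window-coprime {n} {x} {y} i j {i<j} x∣ y∣ 2∤x 3∤x (t∣x , t∣y) =
  ∣6⇒≡1 (∣-trans (F-∣-cancel (n + toℕ i) gap (∣-trans t∣x x∣) (∣-trans t∣y y∣′)) Fgap∣6)
    (λ 2∣t → 2∤x (∣-trans 2∣t t∣x)) (λ 3∣t → 3∤x (∣-trans 3∣t t∣x))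
  where
  gap : ℕ
  gap = toℕ j ∸ toℕ i
  i≤j : toℕ i ≤ toℕ j
  i≤j = <⇒≤ (toWitness i<j)
  y∣′ : y ∣ F (n + toℕ i + gap)
  y∣′ = subst (λ m → y ∣ F m) (sym (trans (+-assoc n (toℕ i) gap) (cong (n +_) (m+[n∸m]≡n i≤j))))
              y∣
  Fgap∣6 : F gap ∣ 6
  Fgap∣6 = F-∣-6 (m<n⇒0<n∸m (toWitness i<j))
                  (≤-trans (m∸n≤m (toℕ j) (toℕ i)) (≤-pred (toℕ<n j)))

prod5-∣-F : ∀ {n K A B} → 1 ≤ n → lcm5 n ∣ K →
            Val 2 (prod5 n) A → 2 ^ A ∣ F K → Val 3 (prod5 n) B → 3 ^ B ∣ F K → prod5 n ∣ F K
prod5-∣-F {n} {K} {A} {B} 1≤n a∣K vA 2^A∣ vB 3^B∣ =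
  subst (_∣ F K) (sym b≡) (coprime-∣-* 6-smooth⊥R (coprime-∣-* (2^⊥3^ A B) 2^A∣ 3^B∣) R∣)
  where
  split : (i : Fin 5) → Split6 (F (n + toℕ i))
  split i = split6-exists (F-pos′ (window-pos 1≤n i))
  r : Fin 5 → ℕ
  r i = Split6.r (split i)
  c : ∀ i j → {True (toℕ i <? toℕ j)} → Coprime (r i) (r j)
  c i j {i<j} = window-coprime {n} i j {i<j} (Split6-r∣ (split i)) (Split6-r∣ (split j))
    (Split6.2∤r (split i)) (Split6.3∤r (split i))
  r∣ : ∀ i → r i ∣ F K
  r∣ i = ∣-trans (Split6-r∣ (split i)) (F-∣-F (∣-trans (lcm5-∣ n i) a∣K))
  s : Split6 (F (n + 0) * F (n + 1) * F (n + 2) * F (n + 3) * F (n + 4))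
  s = Split6-* (Split6-* (Split6-* (Split6-* (split 0F) (split 1F)) (split 2F)) (split 3F)) (split 4F)
  open Split6 s using (e₂; e₃; x≡; 2∤r; 3∤r) renaming (r to R)
  R∣ : R ∣ F K
  R∣ = coprime-∣-* (coprime-*ˡ (coprime-*ˡ (coprime-*ˡ (c 0F 4F) (c 1F 4F)) (c 2F 4F)) (c 3F 4F))
         (coprime-∣-* (coprime-*ˡ (coprime-*ˡ (c 0F 3F) (c 1F 3F)) (c 2F 3F))
           (coprime-∣-* (coprime-*ˡ (c 0F 2F) (c 1F 2F))
             (coprime-∣-* (c 0F 1F) (r∣ 0F) (r∣ 1F)) (r∣ 2F)) (r∣ 3F)) (r∣ 4F)
  prod5≡ : prod5 n ≡ F (n + 0) * F (n + 1) * F (n + 2) * F (n + 3) * F (n + 4)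
  prod5≡ = cong (λ m → F m * F (n + 1) * F (n + 2) * F (n + 3) * F (n + 4)) (sym (+-identityʳ n))
  A≡ : A ≡ e₂
  A≡ = Val-unique prime[2] vA (subst (λ x → Val 2 x e₂) (sym prod5≡) (Split6-val₂ s))
  B≡ : B ≡ e₃
  B≡ = Val-unique prime[3] vB (subst (λ x → Val 3 x e₃) (sym prod5≡) (Split6-val₃ s))
  b≡ : prod5 n ≡ 2 ^ A * 3 ^ B * R
  b≡ = trans prod5≡ (trans x≡ (cong₂ (λ a b → 2 ^ a * 3 ^ b * R) (sym A≡) (sym B≡)))
  6-smooth⊥R : Coprime (2 ^ A * 3 ^ B) R
  6-smooth⊥R = coprime-*ˡ (prime-power-coprime prime[2] A 2∤r) (prime-power-coprime prime[3] B 3∤r)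

-- The exponents of 2 and 3 in z(b) / a

Top : ℕ → ℕ → ℕ → Fin 5 → Set
Top p k n j = p ^ k ∣ n + toℕ j × (∀ i → p ^ suc k ∣ n + toℕ i → i ≡ j)

module _ {p n : ℕ} (p-prime : Prime p) (1≤n : 1 ≤ n) where

  Top⇒Val-lcm5 : ∀ {k j u α} → Top p k n j → Val p (n + toℕ j) u → Val p (lcm5 n) α → α ≡ u
  Top⇒Val-lcm5 {k} {j} {u} {α} (p^k∣ , unique) vu vα = ≤-antisym α≤u u≤α
    where
    u≤α : u ≤ α
    u≤α = Val-≤ p-prime {k = u} (∣-trans (pow-∣ vu) (lcm5-∣ n j)) vα
    k≤u : k ≤ u
    k≤u = Val-≤ p-prime p^k∣ vu
    p^[1+u]∤ : ∀ i → ¬ p ^ suc u ∣ n + toℕ i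
    p^[1+u]∤ i p^[1+u]∣ = pow-∤ vu (subst (λ i → p ^ suc u ∣ n + toℕ i)
                                      (unique i (∣-trans (^-monoʳ-∣ p (s≤s k≤u)) p^[1+u]∣)) p^[1+u]∣)
    α≤u : α ≤ u
    α≤u = ≤-pred (Val-< p-prime {k = suc u} (¬pow-∣-lcm5 1≤n {k = suc u} p-prime p^[1+u]∤) vα)

  ¬Top⇒Val-lcm5 : ∀ {k j u α} → 5 ≤ p ^ suc k → (∃ λ i → p ^ k ∣ n + toℕ i) → ¬ Top p k n j →
                  Val p (n + toℕ j) u → Val p (lcm5 n) α → u < α
  ¬Top⇒Val-lcm5 {k} {j} 5≤ (i , p^k∣i) ¬top vu vα with p ^ k ∣? n + toℕ j
  ... | no p^k∤j  = <-≤-trans (Val-< p-prime {k = k} p^k∤j vu)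
                              (Val-≤ p-prime {k = k} (∣-trans p^k∣i (lcm5-∣ n i)) vα)
  ... | yes p^k∣j = <-≤-trans (Val-< p-prime {k = suc k} p^[1+k]∤j vu)
                              (Val-≤ p-prime {k = suc k} (∣-trans p^[1+k]∣i′ (lcm5-∣ n i′)) vα)
    where
    p^[1+k]∣?_ : ∀ i → Dec (p ^ suc k ∣ n + toℕ i)
    p^[1+k]∣? i = p ^ suc k ∣? n + toℕ i
    other : ∃ λ i → ¬ (p ^ suc k ∣ n + toℕ i → i ≡ j)
    other = ¬∀⟶∃¬ 5 _ (λ i → p^[1+k]∣? i →-dec (i ≟ᶠ j)) (λ unique → ¬top (p^k∣j , unique))
    i′ : Fin 5
    i′ = proj₁ other
    p^[1+k]∣i′ : p ^ suc k ∣ n + toℕ i′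
    p^[1+k]∣i′ = decidable-stable (p^[1+k]∣? i′) λ ∤i′ →
                   proj₂ other λ ∣i′ → contradiction ∣i′ ∤i′
    p^[1+k]∤j : ¬ p ^ suc k ∣ n + toℕ j
    p^[1+k]∤j ∣j = proj₂ other λ _ → window-unique 5≤ p^[1+k]∣i′ ∣j

  single-≤ : ∀ {c A α} (k : Fin 5) → (∀ {f} → Val p (F (n + toℕ k)) f → Val p (prod5 n) f) →
             (∀ {v f} → Val p (n + toℕ k) v → Val p (F (n + toℕ k)) f → f ≤ v + c) →
             Val p (prod5 n) A → Val p (lcm5 n) α → A ≤ α + c
  single-≤ {c} {A} {α} k val-b F-bound vA vα
    with val-exists p-prime (F-pos′ (window-pos 1≤n k)) | val-exists p-prime (window-pos 1≤n k)
  ... | f , vf | v , vv = begin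
    A      ≡⟨ Val-unique p-prime vA (val-b vf) ⟩
    f      ≤⟨ F-bound vv vf ⟩
    v + c  ≤⟨ +-monoˡ-≤ c (Val-≤ p-prime {k = v} (∣-trans (pow-∣ vv) (lcm5-∣ n k)) vα) ⟩
    α + c  ∎
    where open ≤-Reasoning

∸≡⇒≤+ : ∀ {A d e τ} → A ∸ d ≡ e → e ≤ τ → A ≤ τ + d
∸≡⇒≤+ {A} {d} {τ = τ} refl e≤τ =
  ≤-trans (m≤n+m∸n A d) (≤-trans (+-monoʳ-≤ d e≤τ) (≤-reflexive (+-comm d τ)))

≤+⇒∸≤ : ∀ {A d e τ} → A ∸ d ≡ e → A ≤ τ + d → e ≤ τ
≤+⇒∸≤ {A} {d} {τ = τ} refl A≤ = m≤n+o⇒m∸n≤o A d (subst (A ≤_) (+-comm τ d) A≤)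

excess-top : ∀ {A α u c} → A ≡ u + suc c → α ≡ u → A ∸ (α + c) ≡ 1
excess-top {u = u} {c} refl refl = trans ([m+n]∸[m+o]≡n∸o u (suc c) c) (m+n∸n≡m 1 c)

excess-below : ∀ {A α u c} → A ≡ u + suc c → u < α → A ∸ (α + c) ≡ 0
excess-below {u = u} {c} refl u<α = m≤n⇒m∸n≡0 (≤-trans (≤-reflexive (+-suc u c)) (+-monoˡ-≤ c u<α))

Val₂-prod5-at : ℕ → Fin 5 → Set
Val₂-prod5-at n j = 6 ∣ n + toℕ j × (∀ {u} → Val 2 (n + toℕ j) u → Val 2 (prod5 n) (u + 3))

Val₂-prod5-pair : ∀ {n} → 3 ∣ n ⊎ 3 ∣ n + 1 → ∃ (Val₂-prod5-at n)
Val₂-prod5-pair {n} (inj₁ 3∣n) = by-parity (mod-2-cases n)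
  where
  3∤n+1 : ¬ 3 ∣ n + 1
  3∤n+1 3∣ = from-no (3 ∣? 1) (∣m+n∣m⇒∣n 3∣ 3∣n)
  3∤n+2 : ¬ 3 ∣ n + 2
  3∤n+2 3∣ = from-no (3 ∣? 2) (∣m+n∣m⇒∣n 3∣ 3∣n)
  3∣n+3 : 3 ∣ n + 3
  3∣n+3 = ∣m∣n⇒∣m+n 3∣n ∣-refl
  3∤n+4 : ¬ 3 ∣ n + 4
  3∤n+4 = ∤-ahead n 3 1 3∣n+3 (from-no (3 ∣? 1))
  by-parity : 2 ∣ n ⊎ 2 ∣ n + 1 → ∃ (Val₂-prod5-at n)
  by-parity (inj₁ 2∣n) = 0F , subst (6 ∣_) (sym (+-identityʳ n)) 6∣n , λ {u} vu →
    Val-≡ (sum u) (Val-prod5 n prime[2] (Val₂F-6∣ 6∣n (subst (λ x → Val 2 x u) (+-identityʳ n) vu))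
      (Val₂F-0 3∤n+1) (Val₂F-0 3∤n+2) (Val₂F-1 3∣n+3 2∤n+3) (Val₂F-0 3∤n+4))
    where
    6∣n : 6 ∣ n
    6∣n = coprime-∣-* 2⊥3 2∣n 3∣n
    2∤n+3 : ¬ 2 ∣ n + 3
    2∤n+3 2∣ = from-no (2 ∣? 3) (∣m+n∣m⇒∣n 2∣ 2∣n)
    sum : ∀ u → u + 2 + 0 + 0 + 1 + 0 ≡ u + 3
    sum = solve-∀
  by-parity (inj₂ 2∣n+1) = 3F , 6∣n+3 , λ {u} vu →
    Val-≡ (sum u) (Val-prod5 n prime[2] (Val₂F-1 3∣n 2∤n)
      (Val₂F-0 3∤n+1) (Val₂F-0 3∤n+2) (Val₂F-6∣ 6∣n+3 vu) (Val₂F-0 3∤n+4))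
    where
    2∤n : ¬ 2 ∣ n
    2∤n 2∣ = from-no (2 ∣? 1) (∣m+n∣m⇒∣n 2∣n+1 2∣)
    6∣n+3 : 6 ∣ n + 3
    6∣n+3 = coprime-∣-* 2⊥3 (∣-ahead n 1 2 2∣n+1 ∣-refl) 3∣n+3
    sum : ∀ u → 1 + 0 + 0 + (u + 2) + 0 ≡ u + 3
    sum = solve-∀
Val₂-prod5-pair {n} (inj₂ 3∣n+1) = by-parity (mod-2-cases n)
  where
  3∤n : ¬ 3 ∣ n
  3∤n 3∣ = from-no (3 ∣? 1) (∣m+n∣m⇒∣n 3∣n+1 3∣)
  3∤n+2 : ¬ 3 ∣ n + 2
  3∤n+2 = ∤-ahead n 1 1 3∣n+1 (from-no (3 ∣? 1))
  3∤n+3 : ¬ 3 ∣ n + 3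
  3∤n+3 = ∤-ahead n 1 2 3∣n+1 (from-no (3 ∣? 2))
  3∣n+4 : 3 ∣ n + 4
  3∣n+4 = ∣-ahead n 1 3 3∣n+1 ∣-refl
  by-parity : 2 ∣ n ⊎ 2 ∣ n + 1 → ∃ (Val₂-prod5-at n)
  by-parity (inj₁ 2∣n) = 4F , 6∣n+4 , λ {u} vu →
    Val-≡ (sum u) (Val-prod5 n prime[2] (Val₂F-0 3∤n)
      (Val₂F-1 3∣n+1 2∤n+1) (Val₂F-0 3∤n+2) (Val₂F-0 3∤n+3) (Val₂F-6∣ 6∣n+4 vu))
    where
    2∤n+1 : ¬ 2 ∣ n + 1
    2∤n+1 2∣ = from-no (2 ∣? 1) (∣m+n∣m⇒∣n 2∣ 2∣n)
    6∣n+4 : 6 ∣ n + 4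
    6∣n+4 = coprime-∣-* 2⊥3 (∣m∣n⇒∣m+n 2∣n (divides 2 refl)) 3∣n+4
    sum : ∀ u → 0 + 1 + 0 + 0 + (u + 2) ≡ u + 3
    sum = solve-∀
  by-parity (inj₂ 2∣n+1) = 1F , 6∣n+1 , λ {u} vu →
    Val-≡ (sum u) (Val-prod5 n prime[2] (Val₂F-0 3∤n)
      (Val₂F-6∣ 6∣n+1 vu) (Val₂F-0 3∤n+2) (Val₂F-0 3∤n+3) (Val₂F-1 3∣n+4 2∤n+4))
    where
    2∤n+4 : ¬ 2 ∣ n + 4
    2∤n+4 = ∤-ahead n 1 3 2∣n+1 (from-no (2 ∣? 3))
    6∣n+1 : 6 ∣ n + 1
    6∣n+1 = coprime-∣-* 2⊥3 2∣n+1 3∣n+1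
    sum : ∀ u → 0 + (u + 2) + 0 + 0 + 1 ≡ u + 3
    sum = solve-∀

Val₂-prod5-single : ∀ {n f} → 3 ∣ n + 2 → Val 2 (F (n + 2)) f → Val 2 (prod5 n) f
Val₂-prod5-single {n} {f} 3∣n+2 vf = Val-≡ (sum f)
  (Val-prod5 n prime[2] (Val₂F-0 3∤n) (Val₂F-0 3∤n+1) vf (Val₂F-0 3∤n+3) (Val₂F-0 3∤n+4))
  where
  3∤n : ¬ 3 ∣ n
  3∤n 3∣ = from-no (3 ∣? 2) (∣m+n∣m⇒∣n 3∣n+2 3∣)
  3∤n+1 : ¬ 3 ∣ n + 1
  3∤n+1 = ∤-behind n 1 1 3∣n+2 (from-no (3 ∣? 1))
  3∤n+3 : ¬ 3 ∣ n + 3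
  3∤n+3 = ∤-ahead n 2 1 3∣n+2 (from-no (3 ∣? 1))
  3∤n+4 : ¬ 3 ∣ n + 4
  3∤n+4 = ∤-ahead n 2 2 3∣n+2 (from-no (3 ∣? 2))
  sum : ∀ f → 0 + 0 + f + 0 + 0 ≡ f
  sum = solve-∀

Excess₂ : ℕ → ℕ → Set
Excess₂ n e = ∀ {A α} → Val 2 (prod5 n) A → Val 2 (lcm5 n) α → A ∸ (α + 2) ≡ e

Extra₂ : ℕ → Set
Extra₂ n = (3 ∣ n ⊎ 3 ∣ n + 1) × ∃ λ (j : Fin 5) → 12 ∣ n + toℕ j × (∀ i → 8 ∣ n + toℕ i → i ≡ j)

excess₂-1 : ∀ {n} → 1 ≤ n → Extra₂ n → Excess₂ n 1
excess₂-1 {n} 1≤n (pair , j′ , 12∣ , unique) vA vα with Val₂-prod5-pair pair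
... | j , 6∣ , val-b with val-exists prime[2] (window-pos 1≤n j)
... | u , vu = excess-top {c = 2} (Val-unique prime[2] vA (val-b vu))
                 (Top⇒Val-lcm5 prime[2] 1≤n {k = 2} top vu vα)
  where
  top : Top 2 2 n j
  top = subst (Top 2 2 n) (window-unique (n≤1+n 5) (∣-trans (divides 2 refl) 12∣) 6∣)
              (∣-trans (divides 3 refl) 12∣ , unique)

excess₂-0 : ∀ {n} → 1 ≤ n → ¬ Extra₂ n → Excess₂ n 0
excess₂-0 {n} 1≤n ¬extra {A} {α} vA vα =
  [ pair-case ∘ inj₁ , [ pair-case ∘ inj₂ , single-case ]′ ]′ (mod-3-cases n)
  where
  pair-case : 3 ∣ n ⊎ 3 ∣ n + 1 → A ∸ (α + 2) ≡ 0
  pair-case pair with Val₂-prod5-pair pair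
  ... | j , 6∣ , val-b with val-exists prime[2] (window-pos 1≤n j)
  ... | u , vu = excess-below {c = 2} (Val-unique prime[2] vA (val-b vu)) u<α
    where
    ¬top : ¬ Top 2 2 n j
    ¬top (4∣ , unique) = ¬extra (pair , j , coprime-∣-* 3⊥4 (∣-trans (divides 2 refl) 6∣) 4∣ , unique)
    u<α : u < α
    u<α = ¬Top⇒Val-lcm5 prime[2] 1≤n {k = 2} (from-yes (5 ≤? 8))
            (window-multiple 4 (n≤1+n 4) n) ¬top vu vα
  single-case : 3 ∣ n + 2 → A ∸ (α + 2) ≡ 0
  single-case 3∣n+2 = m≤n⇒m∸n≡0 (single-≤ prime[2] 1≤n 2F (Val₂-prod5-single 3∣n+2) Val₂F-≤ vA vα)

Val₃-prod5-4∣ : ∀ {n x y} → 4 ∣ n → Val 3 n x → Val 3 (n + 4) y → Val 3 (prod5 n) (x + y + 2)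
Val₃-prod5-4∣ {n} {x} {y} 4∣n vx vy = Val-≡ (sum x y)
  (Val-prod5 n prime[3] (Val₃F-4∣ 4∣n vx) (Val₃F-0 4∤n+1) (Val₃F-0 4∤n+2) (Val₃F-0 4∤n+3)
    (Val₃F-4∣ (∣m∣n⇒∣m+n 4∣n ∣-refl) vy))
  where
  4∤n+1 : ¬ 4 ∣ n + 1
  4∤n+1 4∣ = from-no (4 ∣? 1) (∣m+n∣m⇒∣n 4∣ 4∣n)
  4∤n+2 : ¬ 4 ∣ n + 2
  4∤n+2 4∣ = from-no (4 ∣? 2) (∣m+n∣m⇒∣n 4∣ 4∣n)
  4∤n+3 : ¬ 4 ∣ n + 3
  4∤n+3 4∣ = from-no (4 ∣? 3) (∣m+n∣m⇒∣n 4∣ 4∣n)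
  sum : ∀ x y → x + 1 + 0 + 0 + 0 + (y + 1) ≡ x + y + 2
  sum = solve-∀

Val₃-prod5-12∣ : ∀ {n u} → 4 ∣ n → (j : Fin 5) → 12 ∣ n + toℕ j →
                 Val 3 (n + toℕ j) u → Val 3 (prod5 n) (u + 2)
Val₃-prod5-12∣ {n} {u} 4∣n 0F 12∣n+0 vu = Val-≡ (cong (_+ 2) (+-identityʳ u))
  (Val₃-prod5-4∣ 4∣n (subst (λ x → Val 3 x u) (+-identityʳ n) vu) (Val-0 prime[3] 3∤n+4))
  where
  3∤n+4 : ¬ 3 ∣ n + 4
  3∤n+4 = ∤-ahead n 0 4 (∣-trans (divides 4 refl) 12∣n+0) (from-no (3 ∣? 4))
Val₃-prod5-12∣ {n} {u} 4∣n 4F 12∣n+4 vu = Val₃-prod5-4∣ 4∣n (Val-0 prime[3] 3∤n) vu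
  where
  3∤n : ¬ 3 ∣ n
  3∤n 3∣ = from-no (3 ∣? 4) (∣m+n∣m⇒∣n (∣-trans (divides 4 refl) 12∣n+4) 3∣)
Val₃-prod5-12∣ 4∣n 1F 12∣ _ = contradiction (∣m+n∣m⇒∣n (∣-trans (divides 3 refl) 12∣) 4∣n) (from-no (4 ∣? 1))
Val₃-prod5-12∣ 4∣n 2F 12∣ _ = contradiction (∣m+n∣m⇒∣n (∣-trans (divides 3 refl) 12∣) 4∣n) (from-no (4 ∣? 2))
Val₃-prod5-12∣ 4∣n 3F 12∣ _ = contradiction (∣m+n∣m⇒∣n (∣-trans (divides 3 refl) 12∣) 4∣n) (from-no (4 ∣? 3))

Val₃-prod5-single : ∀ {n} → ¬ 4 ∣ n →
                    ∃ λ (k : Fin 5) → ∀ {f} → Val 3 (F (n + toℕ k)) f → Val 3 (prod5 n) f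
Val₃-prod5-single {n} 4∤n with mod-4-cases n
... | inj₁ 4∣n = contradiction 4∣n 4∤n
... | inj₂ (inj₁ 4∣n+1) = 1F , λ {f} vf → Val-≡ (sum f)
  (Val-prod5 n prime[3] (Val₃F-0 4∤n) vf
    (Val₃F-0 (∤-ahead n 1 1 4∣n+1 (from-no (4 ∣? 1))))
    (Val₃F-0 (∤-ahead n 1 2 4∣n+1 (from-no (4 ∣? 2))))
    (Val₃F-0 (∤-ahead n 1 3 4∣n+1 (from-no (4 ∣? 3)))))
  where
  sum : ∀ f → 0 + f + 0 + 0 + 0 ≡ f
  sum = solve-∀
... | inj₂ (inj₂ (inj₁ 4∣n+2)) = 2F , λ {f} vf → Val-≡ (sum f)
  (Val-prod5 n prime[3] (Val₃F-0 4∤n)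
    (Val₃F-0 (∤-behind n 1 1 4∣n+2 (from-no (4 ∣? 1))))
    vf
    (Val₃F-0 (∤-ahead n 2 1 4∣n+2 (from-no (4 ∣? 1))))
    (Val₃F-0 (∤-ahead n 2 2 4∣n+2 (from-no (4 ∣? 2)))))
  where
  sum : ∀ f → 0 + 0 + f + 0 + 0 ≡ f
  sum = solve-∀
... | inj₂ (inj₂ (inj₂ 4∣n+3)) = 3F , λ {f} vf → Val-≡ (sum f)
  (Val-prod5 n prime[3] (Val₃F-0 4∤n)
    (Val₃F-0 (∤-behind n 1 2 4∣n+3 (from-no (4 ∣? 2))))
    (Val₃F-0 (∤-behind n 2 1 4∣n+3 (from-no (4 ∣? 1))))
    vf
    (Val₃F-0 (∤-ahead n 3 1 4∣n+3 (from-no (4 ∣? 1)))))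
  where
  sum : ∀ f → 0 + 0 + 0 + f + 0 ≡ f
  sum = solve-∀

Excess₃ : ℕ → ℕ → Set
Excess₃ n e = ∀ {B β} → Val 3 (prod5 n) B → Val 3 (lcm5 n) β → B ∸ (β + 1) ≡ e

Extra₃ : ℕ → Set
Extra₃ n = 4 ∣ n × ∃ λ (j : Fin 5) → 12 ∣ n + toℕ j × (∀ i → 9 ∣ n + toℕ i → i ≡ j)

excess₃-1 : ∀ {n} → 1 ≤ n → Extra₃ n → Excess₃ n 1
excess₃-1 {n} 1≤n (4∣n , j , 12∣ , unique) vB vβ with val-exists prime[3] (window-pos 1≤n j)
... | u , vu = excess-top {c = 1} (Val-unique prime[3] vB (Val₃-prod5-12∣ 4∣n j 12∣ vu))
                 (Top⇒Val-lcm5 prime[3] 1≤n {k = 1} (∣-trans (divides 4 refl) 12∣ , unique) vu vβ)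

excess₃-0 : ∀ {n} → 1 ≤ n → ¬ Extra₃ n → Excess₃ n 0
excess₃-0 {n} 1≤n ¬extra {B} {β} vB vβ = by-4 (4 ∣? n)
  where
  open ≤-Reasoning
  twelve-case : 4 ∣ n → (j : Fin 5) → 12 ∣ n + toℕ j → B ∸ (β + 1) ≡ 0
  twelve-case 4∣n j 12∣ with val-exists prime[3] (window-pos 1≤n j)
  ... | u , vu = excess-below {c = 1} (Val-unique prime[3] vB (Val₃-prod5-12∣ 4∣n j 12∣ vu)) u<β
    where
    ¬top : ¬ Top 3 1 n j
    ¬top (_ , unique) = ¬extra (4∣n , j , 12∣ , unique)
    u<β : u < β
    u<β = ¬Top⇒Val-lcm5 prime[3] 1≤n {k = 1} (from-yes (5 ≤? 9))
            (window-multiple 3 (from-yes (3 ≤? 5)) n) ¬top vu vβ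
  by-3 : 4 ∣ n → Dec (3 ∣ n) → Dec (3 ∣ n + 4) → B ∸ (β + 1) ≡ 0
  by-3 4∣n (yes 3∣n) _ = twelve-case 4∣n 0F (subst (12 ∣_) (sym (+-identityʳ n)) (coprime-∣-* 3⊥4 3∣n 4∣n))
  by-3 4∣n (no _) (yes 3∣n+4) = twelve-case 4∣n 4F (coprime-∣-* 3⊥4 3∣n+4 (∣m∣n⇒∣m+n 4∣n ∣-refl))
  by-3 4∣n (no 3∤n) (no 3∤n+4) = m≤n⇒m∸n≡0 (begin
    B      ≡⟨ Val-unique prime[3] vB (Val₃-prod5-4∣ 4∣n (Val-0 prime[3] 3∤n) (Val-0 prime[3] 3∤n+4)) ⟩
    2      ≤⟨ +-monoˡ-≤ 1 1≤β ⟩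
    β + 1  ∎)
    where
    1≤β : 1 ≤ β
    1≤β with window-multiple 3 (from-yes (3 ≤? 5)) n
    ... | i , 3∣ = Val-≤ prime[3] {k = 1} (∣-trans 3∣ (lcm5-∣ n i)) vβ
  by-4 : Dec (4 ∣ n) → B ∸ (β + 1) ≡ 0
  by-4 (yes 4∣n) = by-3 4∣n (3 ∣? n) (3 ∣? n + 4)
  by-4 (no 4∤n) with Val₃-prod5-single 4∤n
  ... | k , val-b = m≤n⇒m∸n≡0 (single-≤ prime[3] 1≤n k val-b Val₃F-≤ vB vβ)

12∣lcm5 : ∀ n → 12 ∣ lcm5 n
12∣lcm5 n with window-multiple 3 (from-yes (3 ≤? 5)) n | window-multiple 4 (from-yes (4 ≤? 5)) n
... | i , 3∣ | k , 4∣ = coprime-∣-* 3⊥4 (∣-trans 3∣ (lcm5-∣ n i)) (∣-trans 4∣ (lcm5-∣ n k))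

module _ {n : ℕ} (1≤n : 1 ≤ n) where
  private
    a : ℕ
    a = lcm5 n
    6∣a : 6 ∣ a
    6∣a = ∣-trans (divides 2 refl) (12∣lcm5 n)
    4∣a : 4 ∣ a
    4∣a = ∣-trans (divides 3 refl) (12∣lcm5 n)

  Val₂F-*lcm5 : ∀ {t τ α} → Val 2 t τ → Val 2 a α → Val 2 (F (t * a)) (τ + (α + 2))
  Val₂F-*lcm5 {t} {τ} {α} vt vα =
    Val-≡ (+-assoc τ α 2) (Val₂F-6∣ (∣n⇒∣m*n t 6∣a) (Val-* prime[2] vt vα))

  Val₃F-*lcm5 : ∀ {t σ β} → Val 3 t σ → Val 3 a β → Val 3 (F (t * a)) (σ + (β + 1))
  Val₃F-*lcm5 {t} {σ} {β} vt vβ =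
    Val-≡ (+-assoc σ β 1) (Val₃F-4∣ (∣n⇒∣m*n t 4∣a) (Val-* prime[3] vt vβ))

  z-prod5 : ∀ {e₂ e₃} → Excess₂ n e₂ → Excess₃ n e₃ → IsZ (prod5 n) (2 ^ e₂ * 3 ^ e₃ * a)
  z-prod5 {e₂} {e₃} excess₂ excess₃
    with val-exists prime[2] (prod5-pos 1≤n) | val-exists prime[2] (lcm5-pos 1≤n)
       | val-exists prime[3] (prod5-pos 1≤n) | val-exists prime[3] (lcm5-pos 1≤n)
  ... | A , vA | α , vα | B , vB | β , vβ = 1≤K , b∣FK , minimal
    where
    c : ℕ
    c = 2 ^ e₂ * 3 ^ e₃
    e₂≡ : A ∸ (α + 2) ≡ e₂
    e₂≡ = excess₂ vA vα
    e₃≡ : B ∸ (β + 1) ≡ e₃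
    e₃≡ = excess₃ vB vβ
    c-val₂ : Val 2 c e₂
    c-val₂ = Val-≡ (+-identityʳ e₂) (Val-* prime[2] (Val-^ prime[2] e₂) (Val-0 prime[2] (∤-^ e₃ prime[2] 2∤3)))
    c-val₃ : Val 3 c e₃
    c-val₃ = Val-* prime[3] (Val-0 prime[3] (∤-^ e₂ prime[3] 3∤2)) (Val-^ prime[3] e₃)
    1≤K : 1 ≤ c * a
    1≤K = *-mono-≤ (*-mono-≤ (m^n>0 2 e₂) (m^n>0 3 e₃)) (lcm5-pos 1≤n)
    b∣FK : prod5 n ∣ F (c * a)
    b∣FK = prod5-∣-F 1≤n (n∣m*n c)
      vA (Val-∣ prime[2] (∸≡⇒≤+ e₂≡ ≤-refl) (Val₂F-*lcm5 c-val₂ vα))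
      vB (Val-∣ prime[3] (∸≡⇒≤+ e₃≡ ≤-refl) (Val₃F-*lcm5 c-val₃ vβ))
    minimal : ∀ j → 1 ≤ j → j < c * a → ¬ prod5 n ∣ F j
    minimal j 1≤j j<K b∣Fj with prod5-∣-F⇒lcm5-∣ {j = j} 1≤n b∣Fj
    ... | divides t refl = <⇒≱ j<K (*-monoˡ-≤ a (∣⇒≤ {{>-nonZero 1≤t}} c∣t))
      where
      1≤t : 1 ≤ t
      1≤t = n≢0⇒n>0 λ { refl → contradiction 1≤j λ () }
      2^e₂∣t : 2 ^ e₂ ∣ t
      2^e₂∣t with val-exists prime[2] 1≤t
      ... | τ , vτ = Val-∣ prime[2]
        (≤+⇒∸≤ e₂≡ (Val-≤ prime[2] (∣-trans (pow-∣ vA) b∣Fj) (Val₂F-*lcm5 vτ vα))) vτ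
      3^e₃∣t : 3 ^ e₃ ∣ t
      3^e₃∣t with val-exists prime[3] 1≤t
      ... | σ , vσ = Val-∣ prime[3]
        (≤+⇒∸≤ e₃≡ (Val-≤ prime[3] (∣-trans (pow-∣ vB) b∣Fj) (Val₃F-*lcm5 vσ vβ))) vσ
      c∣t : c ∣ t
      c∣t = coprime-∣-* (2^⊥3^ e₂ e₃) 2^e₂∣t 3^e₃∣t

-- Reduction modulo 72

extra₂? : ∀ n → Dec (Extra₂ n)
extra₂? n = (3 ∣? n ⊎-dec 3 ∣? n + 1)
      ×-dec any? (λ j → 12 ∣? n + toℕ j ×-dec all? (λ i → 8 ∣? n + toℕ i →-dec i ≟ᶠ j))

extra₃? : ∀ n → Dec (Extra₃ n)
extra₃? n = 4 ∣? n
      ×-dec any? (λ j → 12 ∣? n + toℕ j ×-dec all? (λ i → 9 ∣? n + toℕ i →-dec i ≟ᶠ j))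

module _ (n : ℕ) where
  private
    r : ℕ
    r = n % 72
    ↑ : ∀ {d} k → d ∣ 72 → d ∣ r + k → d ∣ n + k
    ↑ k d∣72 = ∣-%-+ 72 n k d∣72
    ↓ : ∀ {d} k → d ∣ 72 → d ∣ n + k → d ∣ r + k
    ↓ k d∣72 = ∣-+-% 72 n k d∣72

  Extra₂-↑ : Extra₂ r → Extra₂ n
  Extra₂-↑ (pair , j , 12∣ , unique) =
    [ inj₁ ∘ ∣n∣m%n⇒∣m (divides 24 refl) , inj₂ ∘ ↑ 1 (divides 24 refl) ]′ pair
    , j , ↑ (toℕ j) (divides 6 refl) 12∣ , λ i 8∣ → unique i (↓ (toℕ i) (divides 9 refl) 8∣)

  Extra₂-↓ : Extra₂ n → Extra₂ r
  Extra₂-↓ (pair , j , 12∣ , unique) =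
    [ inj₁ ∘ (λ 3∣n → %-presˡ-∣ 3∣n (divides 24 refl)) , inj₂ ∘ ↓ 1 (divides 24 refl) ]′ pair
    , j , ↓ (toℕ j) (divides 6 refl) 12∣ , λ i 8∣ → unique i (↑ (toℕ i) (divides 9 refl) 8∣)

  Extra₃-↑ : Extra₃ r → Extra₃ n
  Extra₃-↑ (4∣ , j , 12∣ , unique) =
    ∣n∣m%n⇒∣m (divides 18 refl) 4∣
    , j , ↑ (toℕ j) (divides 6 refl) 12∣ , λ i 9∣ → unique i (↓ (toℕ i) (divides 8 refl) 9∣)

  Extra₃-↓ : Extra₃ n → Extra₃ r
  Extra₃-↓ (4∣ , j , 12∣ , unique) =
    %-presˡ-∣ 4∣ (divides 18 refl)
    , j , ↓ (toℕ j) (divides 6 refl) 12∣ , λ i 9∣ → unique i (↑ (toℕ i) (divides 8 refl) 9∣)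

Row : ℕ → Set
Row n =
    (((n % 12) ∈ (1 ∷ 2 ∷ 3 ∷ 4 ∷ 5 ∷ 6 ∷ 7 ∷ 10 ∷ []) ⊎ (n % 72) ∈ (8 ∷ 60 ∷ []))
      → ¬ Extra₂ n × ¬ Extra₃ n)
  × (((n % 12) ∈ (9 ∷ 11 ∷ []) ⊎ (n % 72) ∈ (24 ∷ 44 ∷ []))
      → Extra₂ n × ¬ Extra₃ n)
  × ((n % 72) ∈ (12 ∷ 32 ∷ 36 ∷ 56 ∷ [])
      → ¬ Extra₂ n × Extra₃ n)
  × ((n % 72) ∈ (0 ∷ 20 ∷ 48 ∷ 68 ∷ [])
      → Extra₂ n × Extra₃ n)

row? : ∀ n → Dec (Row n)
row? n =
        ((n % 12 ∈? (1 ∷ 2 ∷ 3 ∷ 4 ∷ 5 ∷ 6 ∷ 7 ∷ 10 ∷ []) ⊎-dec n % 72 ∈? (8 ∷ 60 ∷ []))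
          →-dec ¬? x₂ ×-dec ¬? x₃)
  ×-dec ((n % 12 ∈? (9 ∷ 11 ∷ []) ⊎-dec n % 72 ∈? (24 ∷ 44 ∷ []))
          →-dec x₂ ×-dec ¬? x₃)
  ×-dec (n % 72 ∈? (12 ∷ 32 ∷ 36 ∷ 56 ∷ [])
          →-dec ¬? x₂ ×-dec x₃)
  ×-dec (n % 72 ∈? (0 ∷ 20 ∷ 48 ∷ 68 ∷ [])
          →-dec x₂ ×-dec x₃)
  where
  x₂ : Dec (Extra₂ n)
  x₂ = extra₂? n
  x₃ : Dec (Extra₃ n)
  x₃ = extra₃? n

Row-↑ : ∀ n → Row (n % 72) → Row n
Row-↑ n (r₁ , r₂ , r₃ , r₄) =
    (λ c → ¬↑ (r₁ (map⊎ mod12 mod72 c)))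
  , (λ c → ↑¬ (r₂ (map⊎ mod12 mod72 c)))
  , (λ c → ¬↑′ (r₃ (mod72 c)))
  , (λ c → ↑↑ (r₄ (mod72 c)))
  where
  open import Data.Sum using () renaming (map to map⊎)
  mod12 : ∀ {xs} → n % 12 ∈ xs → n % 72 % 12 ∈ xs
  mod12 {xs} = subst (_∈ xs) (sym (m∣n⇒o%n%m≡o%m 12 72 n (divides 6 refl)))
  mod72 : ∀ {xs} → n % 72 ∈ xs → n % 72 % 72 ∈ xs
  mod72 {xs} = subst (_∈ xs) (sym (m%n%n≡m%n n 72))
  ¬↑ : ¬ Extra₂ (n % 72) × ¬ Extra₃ (n % 72) → ¬ Extra₂ n × ¬ Extra₃ n
  ¬↑ (¬x₂ , ¬x₃) = ¬x₂ ∘ Extra₂-↓ n , ¬x₃ ∘ Extra₃-↓ n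
  ↑¬ : Extra₂ (n % 72) × ¬ Extra₃ (n % 72) → Extra₂ n × ¬ Extra₃ n
  ↑¬ (x₂ , ¬x₃) = Extra₂-↑ n x₂ , ¬x₃ ∘ Extra₃-↓ n
  ¬↑′ : ¬ Extra₂ (n % 72) × Extra₃ (n % 72) → ¬ Extra₂ n × Extra₃ n
  ¬↑′ (¬x₂ , x₃) = ¬x₂ ∘ Extra₂-↓ n , Extra₃-↑ n x₃
  ↑↑ : Extra₂ (n % 72) × Extra₃ (n % 72) → Extra₂ n × Extra₃ n
  ↑↑ (x₂ , x₃) = Extra₂-↑ n x₂ , Extra₃-↑ n x₃

-- Opaque, so that the case split on `row n` below does not unfold the residue-by-residue check.
opaque
  row : ∀ n → Row n
  row n = Row-↑ n (at-residue 72 row? n)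

theorem3p2 : (n : ℕ) → 1 ≤ n →
    (((n % 12) ∈ (1 ∷ 2 ∷ 3 ∷ 4 ∷ 5 ∷ 6 ∷ 7 ∷ 10 ∷ []) ⊎ (n % 72) ∈ (8 ∷ 60 ∷ []))
      → IsZ (prod5 n) (lcm5 n))
    × (((n % 12) ∈ (9 ∷ 11 ∷ []) ⊎ (n % 72) ∈ (24 ∷ 44 ∷ []))
      → IsZ (prod5 n) (2 * lcm5 n))
    × ((n % 72) ∈ (12 ∷ 32 ∷ 36 ∷ 56 ∷ [])
      → IsZ (prod5 n) (3 * lcm5 n))
    × ((n % 72) ∈ (0 ∷ 20 ∷ 48 ∷ 68 ∷ [])
      → IsZ (prod5 n) (6 * lcm5 n))
theorem3p2 n 1≤n with row n
... | r₁ , r₂ , r₃ , r₄ =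
    (λ c → subst (IsZ (prod5 n)) (*-identityˡ (lcm5 n))
             (z (excess₂-0 1≤n (proj₁ (r₁ c))) (excess₃-0 1≤n (proj₂ (r₁ c)))))
  , (λ c → z (excess₂-1 1≤n (proj₁ (r₂ c))) (excess₃-0 1≤n (proj₂ (r₂ c))))
  , (λ c → z (excess₂-0 1≤n (proj₁ (r₃ c))) (excess₃-1 1≤n (proj₂ (r₃ c))))
  , (λ c → z (excess₂-1 1≤n (proj₁ (r₄ c))) (excess₃-1 1≤n (proj₂ (r₄ c))))
  where
  z : ∀ {e₂ e₃} → Excess₂ n e₂ → Excess₃ n e₃ → IsZ (prod5 n) (2 ^ e₂ * 3 ^ e₃ * lcm5 n)
  z = z-prod5 1≤n
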